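{- Let $M$ be an ada and $\theta$ a maximal congruence on $M$. Then no two of the elements $T,F,U$ are $\theta$-related: $(T,F)\notin\theta$, $(T,U)\notin\theta$ and $(F,U)\notin\theta$.
   Context: An ada is an algebra $(M,\vee,\wedge,\neg,(\ )^\downarrow,T,F,U)$ where $(M,\vee,\wedge,\neg)$ is a $C$-algebra, i.e. satisfies for all $\alpha,\beta,\gamma$: $\neg\neg\alpha=\alpha$; $\neg(\alpha\wedge\beta)=\neg\alpha\vee\neg\beta$; $(\alpha\wedge\beta)\wedge\gamma=\alpha\wedge(\beta\wedge\gamma)$; $\alpha\wedge(\beta\vee\gamma)=(\alpha\wedge\beta)\vee(\alpha\wedge\gamma)$; $(\alpha\vee\beta)\wedge\gamma=(\alpha\wedge\gamma)\vee(\neg\alpha\wedge\beta\wedge\gamma)$; $\alpha\vee(\alpha\wedge\beta)=\alpha$; $(\alpha\wedge\beta)\vee(\beta\wedge\alpha)=(\beta\wedge\alpha)\vee(\alpha\wedge\beta)$; $T$ is the two-sided identity for $\wedge$, $F$ the two-sided identity for $\vee$, $U$ the fixed point of $\neg$; and $F^\downarrow=F$, $U^\downarrow=F$, $T^\downarrow=T$, $\alpha\wedge\beta^\downarrow=\alpha\wedge(\alpha\wedge\beta)^\downarrow$, $\alpha^\downarrow\vee\neg(\alpha^\downarrow)=T$, $\alpha=\alpha^\downarrow\vee\alpha$. A maximal congruence is a congruence on $M$ that is maximal among congruences different from $M\times M$. -}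

module Defs where

open import Level using (Level; suc; _⊔_)
open import Relation.Binary.PropositionalEquality using (_≡_)
open import Relation.Binary.Core using (Rel; _⇒_)
open import Relation.Binary.Structures using (IsEquivalence)
import Relation.Nullary as N
open import Data.Sum using (_⊎_)
open import Data.Product using (∃₂)

record Ada (a : Level) : Set (suc a) where
  field
    M    : Set a
    _∨_  : M → M → M
    _∧_  : M → M → M
    ¬_   : M → M
    _↓   : M → M
    T F U : M
  infixr 6 _∨_
  infixr 7 _∧_
  field
    -- C-algebra axioms
    ¬¬       : ∀ α → ¬ (¬ α) ≡ α
    deMorgan : ∀ α β → ¬ (α ∧ β) ≡ (¬ α) ∨ (¬ β)
    ∧-assoc  : ∀ α β γ → (α ∧ β) ∧ γ ≡ α ∧ (β ∧ γ)
    ∧-distˡ  : ∀ α β γ → α ∧ (β ∨ γ) ≡ (α ∧ β) ∨ (α ∧ γ)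
    ∨∧-distʳ : ∀ α β γ → (α ∨ β) ∧ γ ≡ (α ∧ γ) ∨ (((¬ α) ∧ β) ∧ γ)
    absorb   : ∀ α β → α ∨ (α ∧ β) ≡ α
    comm-ish : ∀ α β → (α ∧ β) ∨ (β ∧ α) ≡ (β ∧ α) ∨ (α ∧ β)
    ∧-identityˡ : ∀ α → T ∧ α ≡ α
    ∧-identityʳ : ∀ α → α ∧ T ≡ α
    ∨-identityˡ : ∀ α → F ∨ α ≡ α
    ∨-identityʳ : ∀ α → α ∨ F ≡ α
    ¬U       : ¬ U ≡ U
    F↓ : F ↓ ≡ F
    U↓ : U ↓ ≡ F
    T↓ : T ↓ ≡ T
    ↓-∧ : ∀ α β → α ∧ (β ↓) ≡ α ∧ ((α ∧ β) ↓)
    ↓-excl : ∀ α → (α ↓) ∨ (¬ (α ↓)) ≡ T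
    ↓-∨ : ∀ α → α ≡ (α ↓) ∨ α

module _ {a : Level} (A : Ada a) where
  open Ada A

  record IsCongruence (θ : Rel M a) : Set a where
    field
      isEquivalence : IsEquivalence θ
      ∨-cong : ∀ {x y u v} → θ x y → θ u v → θ (x ∨ u) (y ∨ v)
      ∧-cong : ∀ {x y u v} → θ x y → θ u v → θ (x ∧ u) (y ∧ v)
      ¬-cong : ∀ {x y} → θ x y → θ (¬ x) (¬ y)
      ↓-cong : ∀ {x y} → θ x y → θ (x ↓) (y ↓)

  IsTotal : Rel M a → Set a
  IsTotal θ = ∀ x y → θ x y

  record IsMaximalCongruence (θ : Rel M a) : Set (suc a) where
    field
      isCongruence : IsCongruence θ
      proper       : N.¬ IsTotal θ
      maximal      : ∀ (ψ : Rel M a) → IsCongruence ψ → θ ⇒ ψ →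
                     (ψ ⇒ θ) ⊎ IsTotal ψ

-- A congruence relating T and F relates everything, since F is absorbing for ∧
-- and T is its identity.  Applying ↓ to T θ U yields T↓ θ U↓, i.e. T θ F; applying
-- ¬ to F θ U yields ¬F θ ¬U, i.e. T θ U.  So a proper congruence relates no two of
-- T, F, U.
module Submission where

open import Defs
open import Level using (Level)
open import Relation.Binary.Core using (Rel)
open import Relation.Binary.Structures using (IsEquivalence)
open import Relation.Nullary using (¬_)
open import Data.Product using (_×_; _,_)
open import Relation.Binary.PropositionalEquality using (_≡_; sym; trans; subst; subst₂)

module AdaProperties {a : Level} (A : Ada a) where
  open Ada A renaming (¬_ to ~_)

  ∧-zeroˡ : ∀ x → F ∧ x ≡ F
  ∧-zeroˡ x = trans (sym (∨-identityˡ (F ∧ x))) (absorb F x)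

  ~F≡T : ~ F ≡ T
  ~F≡T = trans (sym (∨-identityˡ (~ F))) (subst (λ z → z ∨ ~ z ≡ T) F↓ (↓-excl F))

module CongruenceProperties {a : Level} (A : Ada a) {θ : Rel (Ada.M A) a}
                            (isCongruence : IsCongruence A θ) where
  open Ada A renaming (¬_ to ~_)
  open AdaProperties A
  open IsCongruence isCongruence
  open IsEquivalence isEquivalence renaming (refl to θ-refl; sym to θ-sym; trans to θ-trans)

  T≈F⇒total : θ T F → IsTotal A θ
  T≈F⇒total T≈F x y = θ-trans (≈F x) (θ-sym (≈F y))
    where
      ≈F : ∀ x → θ x F
      ≈F x = subst₂ θ (∧-identityˡ x) (∧-zeroˡ x) (∧-cong T≈F θ-refl)

  T≈U⇒T≈F : θ T U → θ T F
  T≈U⇒T≈F T≈U = subst₂ θ T↓ U↓ (↓-cong T≈U)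

  F≈U⇒T≈U : θ F U → θ T U
  F≈U⇒T≈U F≈U = subst₂ θ ~F≡T ¬U (¬-cong F≈U)

proposition3p2 : ∀ {a : Level} (A : Ada a) (θ : Rel (Ada.M A) a) → IsMaximalCongruence A θ → (¬ θ (Ada.T A) (Ada.F A)) × (¬ θ (Ada.T A) (Ada.U A)) × (¬ θ (Ada.F A) (Ada.U A))
proposition3p2 A θ maximal = T≉F , T≉U , F≉U
  where
    open IsMaximalCongruence maximal
    open CongruenceProperties A isCongruence

    T≉F : ¬ θ (Ada.T A) (Ada.F A)
    T≉F T≈F = proper (T≈F⇒total T≈F)

    T≉U : ¬ θ (Ada.T A) (Ada.U A)
    T≉U T≈U = T≉F (T≈U⇒T≈F T≈U)

    F≉U : ¬ θ (Ada.F A) (Ada.U A)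
    F≉U F≈U = T≉U (F≈U⇒T≈U F≈U)
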